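{- Let $r\geq 3$ be an integer and $t:=v(r-2)$. Then for all integers $j\geq 3$, $v\left(\binom{r}{j}\right)+j\geq t+2$ (with $\binom{r}{j}=0$ and $v(0)=\infty$ for $j>r$).
   Context: $v$ is the $2$-adic valuation on $\mathbb{Q}$ with $v(2)=1$. -}

module Defs where

open import Data.Nat using (ℕ; _+_; _^_; suc)
open import Data.Nat.Divisibility using (_∣_)
open import Data.Product using (_×_)
open import Relation.Nullary using (¬_)

-- IsVal2 n k : the 2-adic valuation of the natural number n is k,
-- i.e. 2^k divides n and 2^(k+1) does not.  (Only satisfiable for n ≠ 0;
-- v(0) = ∞ corresponds to no finite k satisfying it.)
IsVal2 : ℕ → ℕ → Set
IsVal2 n k = (2 ^ k ∣ n) × ¬ (2 ^ suc k ∣ n)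

-- Applying absorption k·C(n,k) = n·C(n-1,k-1) three times gives
-- j(j-1)(j-2)·C(r,j) = r(r-1)(r-2)·C(r-3,j-3).  The right side is divisible
-- by 2^(t+1): r-2 supplies 2^t and one of r-1, r is even.  On the left,
-- v(j(j-1)(j-2)) ≤ j-1, so v(C(r,j)) ≥ t+1-(j-1).
module Submission where

open import Defs
open import Data.Nat using (ℕ; zero; suc; _+_; _*_; _^_; _∸_; _≤_; _<_; z≤n; s≤s; NonZero)
open import Data.Nat.Properties
open import Data.Nat.Divisibility
open import Data.Nat.Combinatorics using (_C_; nCk+nC[k+1]≡[n+1]C[k+1]; nC1≡n)
open import Data.Nat.Induction using (<-rec)
open import Data.Nat.Primality using (prime[2]; euclidsLemma)
open import Data.Nat.Tactic.RingSolver using (solve-∀)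
open import Data.Product using (_×_; _,_; ∃-syntax)
open import Data.Sum using (_⊎_; inj₁; inj₂)
open import Relation.Nullary using (¬_; yes; no; contradiction)
open import Relation.Binary.PropositionalEquality

absorption : ∀ n k → suc k * (suc n C suc k) ≡ suc n * (n C k)
absorption zero    zero    = refl
absorption zero    (suc k) = *-zeroʳ (suc (suc k))
absorption (suc n) zero    = begin
  1 * (suc (suc n) C 1) ≡⟨ *-identityˡ _ ⟩
  suc (suc n) C 1       ≡⟨ nC1≡n (suc (suc n)) ⟩
  suc (suc n)           ≡⟨ *-identityʳ _ ⟨
  suc (suc n) * 1       ∎
  where open ≡-Reasoning
absorption (suc n) (suc k) = begin
  suc (suc k) * (suc (suc n) C suc (suc k))
    ≡⟨ cong (suc (suc k) *_) (nCk+nC[k+1]≡[n+1]C[k+1] (suc n) (suc k)) ⟨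
  suc (suc k) * (A + B)
    ≡⟨ regroup k A B ⟩
  A + (suc k * A + suc (suc k) * B)
    ≡⟨ cong₂ (λ u v → A + (u + v)) (absorption n k) (absorption n (suc k)) ⟩
  A + (suc n * (n C k) + suc n * (n C suc k))
    ≡⟨ cong (A +_) (*-distribˡ-+ (suc n) (n C k) (n C suc k)) ⟨
  A + suc n * (n C k + n C suc k)
    ≡⟨ cong (λ u → A + suc n * u) (nCk+nC[k+1]≡[n+1]C[k+1] n k) ⟩
  suc (suc n) * A ∎
  where
  open ≡-Reasoning
  A = suc n C suc k
  B = suc n C suc (suc k)
  regroup : ∀ k A B → suc (suc k) * (A + B) ≡ A + (suc k * A + suc (suc k) * B)
  regroup = solve-∀

rising3 : ℕ → ℕ
rising3 n = n * (suc n * suc (suc n))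

absorption³ : ∀ n k →
  rising3 (suc k) * (suc (suc (suc n)) C suc (suc (suc k))) ≡ rising3 (suc n) * (n C k)
absorption³ n k = begin
  rising3 k₁ * (n₃ C k₃)            ≡⟨ assoc k₁ k₂ k₃ (n₃ C k₃) ⟩
  k₁ * (k₂ * (k₃ * (n₃ C k₃)))      ≡⟨ cong (λ u → k₁ * (k₂ * u)) (absorption n₂ k₂) ⟩
  k₁ * (k₂ * (n₃ * (n₂ C k₂)))      ≡⟨ swap k₁ k₂ n₃ (n₂ C k₂) ⟩
  n₃ * (k₁ * (k₂ * (n₂ C k₂)))      ≡⟨ cong (λ u → n₃ * (k₁ * u)) (absorption n₁ k₁) ⟩
  n₃ * (k₁ * (n₂ * (n₁ C k₁)))      ≡⟨ cong (n₃ *_) (swap′ k₁ n₂ (n₁ C k₁)) ⟩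
  n₃ * (n₂ * (k₁ * (n₁ C k₁)))      ≡⟨ cong (λ u → n₃ * (n₂ * u)) (absorption n k) ⟩
  n₃ * (n₂ * (n₁ * (n C k)))        ≡⟨ reverse n₃ n₂ n₁ (n C k) ⟩
  rising3 n₁ * (n C k)              ∎
  where
  open ≡-Reasoning
  n₁ = suc n ; n₂ = suc n₁ ; n₃ = suc n₂
  k₁ = suc k ; k₂ = suc k₁ ; k₃ = suc k₂
  assoc : ∀ a b c x → a * (b * c) * x ≡ a * (b * (c * x))
  assoc = solve-∀
  swap : ∀ a b c x → a * (b * (c * x)) ≡ c * (a * (b * x))
  swap = solve-∀
  swap′ : ∀ a b x → a * (b * x) ≡ b * (a * x)
  swap′ = solve-∀
  reverse : ∀ a b c x → a * (b * (c * x)) ≡ c * (b * a) * x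
  reverse = solve-∀

2∣n⊎2∣1+n : ∀ n → 2 ∣ n ⊎ 2 ∣ suc n
2∣n⊎2∣1+n zero    = inj₁ (2 ∣0)
2∣n⊎2∣1+n (suc n) with 2∣n⊎2∣1+n n
... | inj₁ 2∣n   = inj₂ (∣m∣n⇒∣m+n (∣-refl {2}) 2∣n)
... | inj₂ 2∣1+n = inj₁ 2∣1+n

2∣n⇒2∤1+n : ∀ {n} → 2 ∣ n → ¬ 2 ∣ suc n
2∣n⇒2∤1+n 2∣n 2∣1+n with ∣1⇒≡1 (∣m+n∣m⇒∣n (subst (2 ∣_) (+-comm 1 _) 2∣1+n) 2∣n)
... | ()

2∣n⇒2∣2+n : ∀ {n} → 2 ∣ n → 2 ∣ suc (suc n)
2∣n⇒2∣2+n = ∣m∣n⇒∣m+n (∣-refl {2})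

2∤m⇒2∤n⇒2∤m*n : ∀ {m n} → ¬ 2 ∣ m → ¬ 2 ∣ n → ¬ 2 ∣ m * n
2∤m⇒2∤n⇒2∤m*n {m} {n} 2∤m 2∤n 2∣m*n with euclidsLemma m n prime[2] 2∣m*n
... | inj₁ 2∣m = 2∤m 2∣m
... | inj₂ 2∣n = 2∤n 2∣n

2^k∣o*n⇒2^k∣n : ∀ k {o n} → ¬ 2 ∣ o → 2 ^ k ∣ o * n → 2 ^ k ∣ n
2^k∣o*n⇒2^k∣n zero    {o} {n} _   _ = 1∣ n
2^k∣o*n⇒2^k∣n (suc k) {o} {n} 2∤o 2^[1+k]∣o*n
  with euclidsLemma o n prime[2] (m*n∣⇒m∣ 2 (2 ^ k) 2^[1+k]∣o*n)
... | inj₁ 2∣o = contradiction 2∣o 2∤o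
... | inj₂ (divides q refl) = subst (2 ^ suc k ∣_) (*-comm 2 q) (*-monoʳ-∣ 2 2^k∣q)
  where
  2^k∣q : 2 ^ k ∣ q
  2^k∣q = 2^k∣o*n⇒2^k∣n k 2∤o
    (*-cancelˡ-∣ 2 (subst (2 ^ suc k ∣_) (regroup o q) 2^[1+k]∣o*n))
    where
    regroup : ∀ o q → o * (q * 2) ≡ 2 * (o * q)
    regroup = solve-∀

^-monoʳ-∣ : ∀ b {m n} → m ≤ n → b ^ m ∣ b ^ n
^-monoʳ-∣ b {n = n} z≤n = 1∣ (b ^ n)
^-monoʳ-∣ b (s≤s m≤n)   = *-monoʳ-∣ b (^-monoʳ-∣ b m≤n)

n<2^n : ∀ n → n < 2 ^ n
n<2^n zero    = s≤s z≤n
n<2^n (suc n) = subst (_≤ 2 ^ suc n) (+-comm (suc n) 1)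
  (+-mono-≤ (n<2^n n) (≤-trans (m^n>0 2 n) (m≤m+n (2 ^ n) 0)))

infix 4 _≡2^_·odd

record _≡2^_·odd (n e : ℕ) : Set where
  constructor mk
  field
    oddPart : ℕ
    odd     : ¬ 2 ∣ oddPart
    n≡2^e*o : n ≡ 2 ^ e * oddPart

odd⇒≡2^0·odd : ∀ {n} → ¬ 2 ∣ n → n ≡2^ 0 ·odd
odd⇒≡2^0·odd {n} 2∤n = mk n 2∤n (sym (*-identityˡ n))

2*-≡2^·odd : ∀ {n e} → n ≡2^ e ·odd → 2 * n ≡2^ suc e ·odd
2*-≡2^·odd {e = e} (mk o 2∤o n≡2^e*o) =
  mk o 2∤o (trans (cong (2 *_) n≡2^e*o) (sym (*-assoc 2 (2 ^ e) o)))

*-≡2^·odd : ∀ {m n a b} → m ≡2^ a ·odd → n ≡2^ b ·odd → m * n ≡2^ a + b ·odd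
*-≡2^·odd {m} {n} {a} {b} (mk o₁ 2∤o₁ m≡) (mk o₂ 2∤o₂ n≡) =
  mk (o₁ * o₂) (2∤m⇒2∤n⇒2∤m*n 2∤o₁ 2∤o₂) (begin
    m * n                         ≡⟨ cong₂ _*_ m≡ n≡ ⟩
    2 ^ a * o₁ * (2 ^ b * o₂)     ≡⟨ interchange (2 ^ a) o₁ (2 ^ b) o₂ ⟩
    2 ^ a * 2 ^ b * (o₁ * o₂)     ≡⟨ cong (_* (o₁ * o₂)) (^-distribˡ-+-* 2 a b) ⟨
    2 ^ (a + b) * (o₁ * o₂)       ∎)
  where
  open ≡-Reasoning
  interchange : ∀ p o q o′ → p * o * (q * o′) ≡ p * q * (o * o′)
  interchange = solve-∀

≡2^·odd-exists : ∀ n → .{{NonZero n}} → ∃[ e ] n ≡2^ e ·odd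
≡2^·odd-exists = <-rec (λ n → .{{NonZero n}} → ∃[ e ] n ≡2^ e ·odd) split
  where
  split : ∀ n → (∀ {m} → m < n → .{{NonZero m}} → ∃[ e ] m ≡2^ e ·odd) →
          .{{NonZero n}} → ∃[ e ] n ≡2^ e ·odd
  split n rec with 2 ∣? n
  ... | no 2∤n  = 0 , odd⇒≡2^0·odd 2∤n
  ... | yes 2∣n with rec (quotient-< 2∣n) {{quotient≢0 2∣n}}
  ...   | e , q≡2^e·odd =
    suc e , subst (_≡2^ suc e ·odd) (sym (m∣n⇒n≡m*quotient 2∣n)) (2*-≡2^·odd q≡2^e·odd)

≡2^·odd⇒< : ∀ {n e} → .{{NonZero n}} → n ≡2^ e ·odd → e < n
≡2^·odd⇒< {n} {e} (mk o _ n≡2^e*o) =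
  <-≤-trans (n<2^n e) (∣⇒≤ (subst (2 ^ e ∣_) (sym n≡2^e*o) (m∣m*n o)))

≡2^·odd⇒≤+ : ∀ {n e x} a k → n ≡2^ e ·odd → 2 ^ a ∣ n * x → ¬ 2 ^ suc k ∣ x → a ≤ e + k
≡2^·odd⇒≤+ {n} {e} {x} a k (mk o 2∤o n≡2^e*o) 2^a∣nx 2^[1+k]∤x with a ≤? e + k
... | yes a≤e+k = a≤e+k
... | no  a≰e+k = contradiction (2^k∣o*n⇒2^k∣n (suc k) 2∤o 2^[1+k]∣ox) 2^[1+k]∤x
  where
  e+[1+k]≤a : e + suc k ≤ a
  e+[1+k]≤a = subst (_≤ a) (sym (+-suc e k)) (≰⇒> a≰e+k)
  2^e*2^[1+k]∣2^e*ox : 2 ^ e * 2 ^ suc k ∣ 2 ^ e * (o * x)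
  2^e*2^[1+k]∣2^e*ox = subst₂ _∣_ (^-distribˡ-+-* 2 e (suc k))
    (trans (cong (_* x) n≡2^e*o) (*-assoc (2 ^ e) o x))
    (∣-trans (^-monoʳ-∣ 2 e+[1+k]≤a) 2^a∣nx)
  2^[1+k]∣ox : 2 ^ suc k ∣ o * x
  2^[1+k]∣ox = *-cancelˡ-∣ (2 ^ e) {{m^n≢0 2 e}} 2^e*2^[1+k]∣2^e*ox

2^t∣n⇒2^[1+t]∣rising3 : ∀ {n t} → 2 ^ t ∣ n → 2 ^ suc t ∣ rising3 n
2^t∣n⇒2^[1+t]∣rising3 {n} {t} 2^t∣n =
  subst (_∣ rising3 n) (*-comm (2 ^ t) 2) (*-pres-∣ 2^t∣n 2∣[1+n][2+n])
  where
  2∣[1+n][2+n] : 2 ∣ suc n * suc (suc n)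
  2∣[1+n][2+n] with 2∣n⊎2∣1+n n
  ... | inj₁ 2∣n   = ∣n⇒∣m*n (suc n) (2∣n⇒2∣2+n 2∣n)
  ... | inj₂ 2∣1+n = ∣m⇒∣m*n (suc (suc n)) 2∣1+n

rising3-≡2^·odd : ∀ m → .{{NonZero m}} → ∃[ e ] rising3 m ≡2^ e ·odd × e ≤ suc m
rising3-≡2^·odd m with 2∣n⊎2∣1+n m
... | inj₂ 2∣1+m with ≡2^·odd-exists (suc m)
...   | e , 1+m≡2^e·odd =
  0 + (e + 0) ,
  *-≡2^·odd (odd⇒≡2^0·odd 2∤m)
    (*-≡2^·odd 1+m≡2^e·odd (odd⇒≡2^0·odd (2∣n⇒2∤1+n 2∣1+m))) ,
  subst (_≤ suc m) (sym (+-identityʳ e)) (<⇒≤ (≡2^·odd⇒< 1+m≡2^e·odd))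
  where
  2∤m : ¬ 2 ∣ m
  2∤m 2∣m = 2∣n⇒2∤1+n 2∣m 2∣1+m
rising3-≡2^·odd m | inj₁ 2∣m with ≡2^·odd-exists q {{quotient≢0 2∣m}} | ≡2^·odd-exists (suc q)
  where q = quotient 2∣m
... | e₁ , q≡2^e₁·odd | e₂ , 1+q≡2^e₂·odd =
  suc e₁ + (0 + suc e₂) ,
  *-≡2^·odd (subst (_≡2^ suc e₁ ·odd) (sym m≡2q) (2*-≡2^·odd q≡2^e₁·odd))
    (*-≡2^·odd (odd⇒≡2^0·odd (2∣n⇒2∤1+n 2∣m))
      (subst (_≡2^ suc e₂ ·odd) (sym 2+m≡2[1+q]) (2*-≡2^·odd 1+q≡2^e₂·odd))) ,
  (begin
    suc e₁ + suc e₂  ≤⟨ +-mono-≤ (≡2^·odd⇒< {{quotient≢0 2∣m}} q≡2^e₁·odd)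
                                 (≡2^·odd⇒< 1+q≡2^e₂·odd) ⟩
    q + suc q        ≡⟨ double+1 q ⟩
    suc (2 * q)      ≡⟨ cong suc m≡2q ⟨
    suc m            ∎)
  where
  open ≤-Reasoning
  q = quotient 2∣m
  m≡2q : m ≡ 2 * q
  m≡2q = m∣n⇒n≡m*quotient 2∣m
  2+m≡2[1+q] : suc (suc m) ≡ 2 * suc q
  2+m≡2[1+q] = trans (cong (λ n → suc (suc n)) m≡2q) (sym (*-suc 2 q))
  double+1 : ∀ q → q + suc q ≡ suc (2 * q)
  double+1 = solve-∀

lemma4p2 : (r t : ℕ) → 3 ≤ r → IsVal2 (r ∸ 2) t →
    (j k : ℕ) → 3 ≤ j → IsVal2 (r C j) k → t + 2 ≤ k + j
lemma4p2 (suc (suc (suc s))) t (s≤s (s≤s (s≤s _))) (2^t∣1+s , _)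
         (suc (suc (suc i))) k (s≤s (s≤s (s≤s _))) (_ , 2^[1+k]∤rCj)
  with rising3-≡2^·odd (suc i)
... | e , rising3[1+i]≡2^e·odd , e≤2+i = begin
  t + 2                    ≡⟨ +-comm t 2 ⟩
  suc (suc t)              ≤⟨ s≤s 1+t≤e+k ⟩
  suc (e + k)              ≤⟨ s≤s (+-monoˡ-≤ k e≤2+i) ⟩
  suc (suc (suc i)) + k    ≡⟨ +-comm (suc (suc (suc i))) k ⟩
  k + suc (suc (suc i))    ∎
  where
  open ≤-Reasoning
  2^[1+t]∣ : 2 ^ suc t ∣ rising3 (suc i) * (suc (suc (suc s)) C suc (suc (suc i)))
  2^[1+t]∣ = subst (2 ^ suc t ∣_) (sym (absorption³ s i))
    (∣m⇒∣m*n (s C i) (2^t∣n⇒2^[1+t]∣rising3 {t = t} 2^t∣1+s))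
  1+t≤e+k : suc t ≤ e + k
  1+t≤e+k = ≡2^·odd⇒≤+ (suc t) k rising3[1+i]≡2^e·odd 2^[1+t]∣ 2^[1+k]∤rCj
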